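{- Let $M=(E,\mathcal{I})$ be a matroid on a finite set $E$ with $r(M)>0$. Then $|F(M)|=r(M)$ if and only if $M$ is a unique expansion matroid.
   Context: $\mathcal{B}(M)$ is the family of bases of $M$, $r(M)$ the common cardinality of bases, and $r(X)$ the rank of $X\subseteq E$ (maximum size of an independent subset of $X$). $s(M)=\{A\in\mathcal{I}: |A|=r(M)-1\}$. For $X\subseteq E$, $K_M(X)=\{a\in E: r(X\cup\{a\})=r(X)+1\}$. $F(M)=\{K_M(X): X\in s(M)\}$ (a set, so equal blocks counted once). $M$ is a unique expansion matroid if for every $B\in\mathcal{B}(M)$ and every $A\in s(M)$, whenever $e_1,e_2\in B$ satisfy $A\cup\{e_1\},A\cup\{e_2\}\in\mathcal{B}(M)$, we have $e_1=e_2$. -}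

module Defs where

open import Data.Nat using (ℕ; zero; suc; _<_; _∸_; _+_; _⊔_)
import Data.Nat as ℕ
open import Data.Bool using (Bool; true; false)
import Data.Bool as Bool
open import Data.Fin using (Fin)
open import Data.Fin.Subset using (Subset; _∈_; _∉_; _⊆_; _∪_; ⁅_⁆; ∣_∣; ⊥; ⊤)
open import Data.Fin.Subset.Properties using (_⊆?_)
open import Data.Vec using (Vec; []; _∷_; tabulate)
open import Data.Vec.Properties using (≡-dec)
open import Data.List using (List; []; _∷_; map; _++_; filter; foldr; length; deduplicate)
open import Data.Product using (_×_; ∃)
open import Relation.Nullary using (¬_; Dec; yes; no)
open import Relation.Nullary.Decidable using (_×-dec_; ⌊_⌋)
open import Relation.Unary using (Pred; Decidable)
open import Relation.Binary.PropositionalEquality using (_≡_)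

record Matroid (n : ℕ) : Set₁ where
  field
    Indep     : Subset n → Set
    indep?    : Decidable Indep
    indep-∅   : Indep ⊥
    indep-⊆   : ∀ {A B} → A ⊆ B → Indep B → Indep A
    augment   : ∀ {A B} → Indep A → Indep B → ∣ A ∣ < ∣ B ∣ →
                ∃ λ x → x ∈ B × x ∉ A × Indep (A ∪ ⁅ x ⁆)

allSubsets : (n : ℕ) → List (Subset n)
allSubsets zero    = [] ∷ []
allSubsets (suc n) = map (false ∷_) (allSubsets n) ++ map (true ∷_) (allSubsets n)

maximum : List ℕ → ℕ
maximum = foldr _⊔_ 0

module _ {n : ℕ} (M : Matroid n) where
  open Matroid M

  rank : Subset n → ℕ
  rank X = maximum (map ∣_∣ (filter (λ A → (A ⊆? X) ×-dec indep? A) (allSubsets n)))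

  r : ℕ
  r = rank ⊤

  IsBase : Subset n → Set
  IsBase B = Indep B × (∀ x → x ∉ B → ¬ Indep (B ∪ ⁅ x ⁆))

  InS : Subset n → Set
  InS A = Indep A × ∣ A ∣ ≡ r ∸ 1

  inS? : Decidable InS
  inS? A = indep? A ×-dec (∣ A ∣ ℕ.≟ r ∸ 1)

  sList : List (Subset n)
  sList = filter inS? (allSubsets n)

  K : Subset n → Subset n
  K X = tabulate (λ a → ⌊ rank (X ∪ ⁅ a ⁆) ℕ.≟ rank X + 1 ⌋)

  cardF : ℕ
  cardF = length (deduplicate (≡-dec Bool._≟_) (map K sList))

  UniqueExpansion : Set
  UniqueExpansion = ∀ B → IsBase B → ∀ A → InS A → ∀ e₁ e₂ → e₁ ∈ B → e₂ ∈ B →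
                    IsBase (A ∪ ⁅ e₁ ⁆) → IsBase (A ∪ ⁅ e₂ ⁆) → e₁ ≡ e₂

-- For A ∈ s(M), K_M(A) is the set of elements a ∉ A with A ∪ {a} a base.
-- Fix a base B. For b ∈ B the set B - b lies in s(M), and K_M(B - b) meets
-- B exactly in b, so the r(M) blocks K_M(B - b) are distinct: |F(M)| ≥ r(M)
-- for every matroid. If the unique expansion property fails, witnessed by
-- A ∪ {e₁} and A ∪ {e₂} with e₁ ≠ e₂ in B, then K_M(A) meets B in two points
-- and is a further block, so |F(M)| > r(M). Conversely, if the property
-- holds, every A ∈ s(M) extends to a base by a unique b ∈ B. An exchange
-- argument shows that if no element of D ∈ s(M) extends A ∈ s(M), then
-- K_M(A) = K_M(D); with D = B - b this gives K_M(A) = K_M(B - b), so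
-- |F(M)| ≤ r(M).
module Submission where

open import Defs
open import Data.Nat using (ℕ; suc; _<_; _≤_; _+_; z≤n; s≤s; pred; >-nonZero; _<?_)
open import Data.Nat.Properties
import Data.Bool as Bool
open import Data.Bool.Properties using (T-≡)
open import Data.Fin using (Fin; zero; suc)
import Data.Fin.Properties as Fin
open import Data.Fin.Subset
  using (Subset; inside; outside; _∈_; _∉_; _⊆_; _∪_; ⁅_⁆; ∣_∣; ⊥; ⊤; _-_)
open import Data.Fin.Subset.Properties
open import Data.Vec using ([]; _∷_; here; there; tabulate)
open import Data.Vec.Properties using (lookup∘tabulate; []=⇒lookup; lookup⇒[]=; ≡-dec)
open import Data.List using (List; []; _∷_; map; filter; length; deduplicate; removeAt)
open import Data.List.Properties using (length-map; length-removeAt′)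
open import Data.List.Membership.Propositional using () renaming (_∈_ to _∈ˡ_)
open import Data.List.Membership.Propositional.Properties
open import Data.List.Relation.Binary.Subset.Propositional using () renaming (_⊆_ to _⊆ˡ_)
open import Data.List.Relation.Unary.Any using (here; there; index)
import Data.List.Relation.Unary.All as All
open import Data.List.Relation.Unary.AllPairs using ([]; _∷_)
open import Data.List.Relation.Unary.Unique.Propositional using (Unique)
import Data.List.Relation.Unary.Unique.Propositional.Properties as Unique
open import Data.List.Relation.Unary.Unique.DecPropositional.Properties using (deduplicate-!)
open import Data.Product using (_×_; _,_; ∃; proj₁; proj₂)
open import Data.Sum using (inj₁; inj₂)
open import Function using (_∘_)
open import Function.Bundles using (_⇔_; mk⇔; Equivalence)
open import Relation.Nullary using (¬_; yes; no; contradiction)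
open import Relation.Nullary.Decidable using (⌊_⌋; toWitness; fromWitness; _×-dec_)
open import Relation.Unary using (Pred; Decidable)
open import Relation.Binary.PropositionalEquality

private
  variable
    n : ℕ

module _ {A : Set} where

  ∈-removeAt⁺ : ∀ {x z} {ys : List A} (x∈ys : x ∈ˡ ys) →
                z ∈ˡ ys → z ≢ x → z ∈ˡ removeAt ys (index x∈ys)
  ∈-removeAt⁺ (here refl) (here refl)  z≢x = contradiction refl z≢x
  ∈-removeAt⁺ (here _)    (there z∈ys) _   = z∈ys
  ∈-removeAt⁺ (there _)   (here refl)  _   = here refl
  ∈-removeAt⁺ (there x∈ys) (there z∈ys) z≢x = there (∈-removeAt⁺ x∈ys z∈ys z≢x)

  Unique⇒length≤ : ∀ {xs ys : List A} → Unique xs → xs ⊆ˡ ys → length xs ≤ length ys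
  Unique⇒length≤ {[]}     _                _      = z≤n
  Unique⇒length≤ {x ∷ xs} {ys} (x∉xs ∷ uniq) xs⊆ys = begin
    suc (length xs)                           ≤⟨ s≤s (Unique⇒length≤ uniq xs⊆ys-x) ⟩
    suc (length (removeAt ys (index x∈ys)))   ≡⟨ length-removeAt′ ys (index x∈ys) ⟨
    length ys                                 ∎
    where
    open ≤-Reasoning
    x∈ys : x ∈ˡ ys
    x∈ys = xs⊆ys (here refl)
    xs⊆ys-x : xs ⊆ˡ removeAt ys (index x∈ys)
    xs⊆ys-x z∈xs = ∈-removeAt⁺ x∈ys (xs⊆ys (there z∈xs)) (All.lookup x∉xs z∈xs ∘ sym)

  Unique-map⁺-∈ : ∀ {B : Set} {f : A → B} {xs} →
                (∀ {x y} → x ∈ˡ xs → y ∈ˡ xs → f x ≡ f y → x ≡ y) →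
                Unique xs → Unique (map f xs)
  Unique-map⁺-∈ {xs = []}     _   _             = []
  Unique-map⁺-∈ {f = f} {x ∷ xs} inj (x∉xs ∷ uniq) =
    All.tabulate fx≢ ∷ Unique-map⁺-∈ (λ x∈ y∈ → inj (there x∈) (there y∈)) uniq
    where
    fx≢ : ∀ {v} → v ∈ˡ map f xs → f x ≢ v
    fx≢ v∈ fx≡v with ∈-map⁻ f v∈
    ... | y , y∈xs , refl = All.lookup x∉xs y∈xs (inj (here refl) (there y∈xs) fx≡v)

≤-maximum : ∀ {m ns} → m ∈ˡ ns → m ≤ maximum ns
≤-maximum {ns = n ∷ ns} (here refl)  = m≤m⊔n n (maximum ns)
≤-maximum {ns = n ∷ ns} (there m∈ns) = ≤-trans (≤-maximum m∈ns) (m≤n⊔m n (maximum ns))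

∈-tabulate-⌊⌋ : ∀ {ℓ} {P : Pred (Fin n) ℓ} (P? : Decidable P) {x} →
                x ∈ tabulate (λ y → ⌊ P? y ⌋) ⇔ P x
∈-tabulate-⌊⌋ P? {x} = mk⇔
  (λ x∈ → toWitness (Equivalence.from T-≡ (trans (sym (lookup∘tabulate _ x)) ([]=⇒lookup x∈))))
  (λ Px → lookup⇒[]= x _ (trans (lookup∘tabulate _ x) (Equivalence.to T-≡ (fromWitness Px))))

x∉p⇒∣p∪⁅x⁆∣≡1+∣p∣ : ∀ (p : Subset n) {x} → x ∉ p → ∣ p ∪ ⁅ x ⁆ ∣ ≡ suc ∣ p ∣
x∉p⇒∣p∪⁅x⁆∣≡1+∣p∣ (outside ∷ p) {zero}  _   = cong (suc ∘ ∣_∣) (∪-identityʳ p)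
x∉p⇒∣p∪⁅x⁆∣≡1+∣p∣ (inside  ∷ p) {zero}  x∉p = contradiction here x∉p
x∉p⇒∣p∪⁅x⁆∣≡1+∣p∣ (outside ∷ p) {suc x} x∉p = x∉p⇒∣p∪⁅x⁆∣≡1+∣p∣ p (x∉p ∘ there)
x∉p⇒∣p∪⁅x⁆∣≡1+∣p∣ (inside  ∷ p) {suc x} x∉p = cong suc (x∉p⇒∣p∪⁅x⁆∣≡1+∣p∣ p (x∉p ∘ there))

x∈p⇒1+∣p-x∣≡∣p∣ : ∀ (p : Subset n) {x} → x ∈ p → suc ∣ p - x ∣ ≡ ∣ p ∣
x∈p⇒1+∣p-x∣≡∣p∣ (inside  ∷ p) {zero}  here      = cong (suc ∘ ∣_∣) (p─⊥≡p p)
x∈p⇒1+∣p-x∣≡∣p∣ (outside ∷ p) {suc x} (there h) = x∈p⇒1+∣p-x∣≡∣p∣ p h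
x∈p⇒1+∣p-x∣≡∣p∣ (inside  ∷ p) {suc x} (there h) = cong suc (x∈p⇒1+∣p-x∣≡∣p∣ p h)

x∉p-x : ∀ (p : Subset n) x → x ∉ p - x
x∉p-x (_ ∷ p) zero    ()
x∉p-x (_ ∷ p) (suc x) (there h) = x∉p-x p x h

x∈p-y⇒x≢y : ∀ (p : Subset n) {x y} → x ∈ p - y → x ≢ y
x∈p-y⇒x≢y p {x} x∈p-y refl = x∉p-x p x x∈p-y

p⊆q∧x∈q⇒p∪⁅x⁆⊆q : ∀ {p q : Subset n} {x} → p ⊆ q → x ∈ q → p ∪ ⁅ x ⁆ ⊆ q
p⊆q∧x∈q⇒p∪⁅x⁆⊆q {p = p} {q} {x} p⊆q x∈q y∈ with x∈p∪q⁻ p ⁅ x ⁆ y∈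
... | inj₁ y∈p   = p⊆q y∈p
... | inj₂ y∈⁅x⁆ = subst (_∈ q) (sym (x∈⁅y⁆⇒x≡y x y∈⁅x⁆)) x∈q

∈p∪⁅x⁆∧∉p⇒≡x : ∀ (p : Subset n) {x y} → y ∈ p ∪ ⁅ x ⁆ → y ∉ p → y ≡ x
∈p∪⁅x⁆∧∉p⇒≡x p {x} y∈ y∉p with x∈p∪q⁻ p ⁅ x ⁆ y∈
... | inj₁ y∈p   = contradiction y∈p y∉p
... | inj₂ y∈⁅x⁆ = x∈⁅y⁆⇒x≡y x y∈⁅x⁆

∈-allSubsets : ∀ (p : Subset n) → p ∈ˡ allSubsets n
∈-allSubsets []            = here refl
∈-allSubsets (outside ∷ p) = ∈-++⁺ˡ (∈-map⁺ (outside ∷_) (∈-allSubsets p))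
∈-allSubsets (inside  ∷ p) = ∈-++⁺ʳ _ (∈-map⁺ (inside ∷_) (∈-allSubsets p))

elements : Subset n → List (Fin n)
elements []            = []
elements (outside ∷ p) = map suc (elements p)
elements (inside  ∷ p) = zero ∷ map suc (elements p)

length-elements : ∀ (p : Subset n) → length (elements p) ≡ ∣ p ∣
length-elements []            = refl
length-elements (outside ∷ p) = trans (length-map suc (elements p)) (length-elements p)
length-elements (inside  ∷ p) = cong suc (trans (length-map suc (elements p)) (length-elements p))

∈-elements⁺ : ∀ (p : Subset n) {x} → x ∈ p → x ∈ˡ elements p
∈-elements⁺ (inside  ∷ p) here      = here refl
∈-elements⁺ (inside  ∷ p) (there h) = there (∈-map⁺ suc (∈-elements⁺ p h))
∈-elements⁺ (outside ∷ p) (there h) = ∈-map⁺ suc (∈-elements⁺ p h)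

∈-elements⁻ : ∀ (p : Subset n) {x} → x ∈ˡ elements p → x ∈ p
∈-elements⁻ (inside  ∷ p) (here refl) = here
∈-elements⁻ (inside  ∷ p) (there h) with ∈-map⁻ suc h
... | _ , h′ , refl = there (∈-elements⁻ p h′)
∈-elements⁻ (outside ∷ p) h with ∈-map⁻ suc h
... | _ , h′ , refl = there (∈-elements⁻ p h′)

elements-unique : ∀ (p : Subset n) → Unique (elements p)
elements-unique []            = []
elements-unique (outside ∷ p) = Unique.map⁺ Fin.suc-injective (elements-unique p)
elements-unique (inside  ∷ p) =
  All.tabulate zero∉ ∷ Unique.map⁺ Fin.suc-injective (elements-unique p)
  where
  zero∉ : ∀ {y} → y ∈ˡ map suc (elements p) → zero ≢ y
  zero∉ y∈ refl with ∈-map⁻ suc y∈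
  ... | _ , _ , ()

module _ (M : Matroid n) where
  open Matroid M

  indepIn? : ∀ X → Decidable (λ I → I ⊆ X × Indep I)
  indepIn? X I = (I ⊆? X) ×-dec indep? I

  rank-≥ : ∀ {I X} → Indep I → I ⊆ X → ∣ I ∣ ≤ rank M X
  rank-≥ {I} {X} iI I⊆X = ≤-maximum (∈-map⁺ ∣_∣ (∈-filter⁺ (indepIn? X) (∈-allSubsets I) (I⊆X , iI)))

  rank-attained : ∀ X → ∃ λ I → I ⊆ X × Indep I × ∣ I ∣ ≡ rank M X
  rank-attained X with foldr-selective ⊔-sel 0 (map ∣_∣ (filter (indepIn? X) (allSubsets n)))
  ... | inj₁ rank≡0 = ⊥ , ⊥⊆ , indep-∅ , trans (∣⊥∣≡0 n) (sym rank≡0)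
  ... | inj₂ rank∈ with ∈-map⁻ ∣_∣ rank∈
  ...   | I , I∈ , rank≡∣I∣ with ∈-filter⁻ (indepIn? X) {xs = allSubsets n} I∈
  ...     | _ , I⊆X , iI = I , I⊆X , iI , sym rank≡∣I∣

  rank-indep : ∀ {A} → Indep A → rank M A ≡ ∣ A ∣
  rank-indep {A} iA with rank-attained A
  ... | I , I⊆A , _ , ∣I∣≡rank =
    ≤-antisym (subst (_≤ ∣ A ∣) ∣I∣≡rank (p⊆q⇒∣p∣≤∣q∣ I⊆A)) (rank-≥ iA ⊆-refl)

  indep⇒∣I∣≤r : ∀ {I} → Indep I → ∣ I ∣ ≤ r M
  indep⇒∣I∣≤r iI = rank-≥ iI ⊆⊤

  base⇒∣B∣≡r : ∀ {B} → IsBase M B → ∣ B ∣ ≡ r M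
  base⇒∣B∣≡r {B} (iB , maximal) with ∣ B ∣ <? r M
  ... | no ∣B∣≮r = ≤-antisym (indep⇒∣I∣≤r iB) (≮⇒≥ ∣B∣≮r)
  ... | yes ∣B∣<r with rank-attained ⊤
  ...   | I , _ , iI , ∣I∣≡r with augment iB iI (subst (∣ B ∣ <_) (sym ∣I∣≡r) ∣B∣<r)
  ...     | x , _ , x∉B , iBx = contradiction iBx (maximal x x∉B)

  indep∧∣B∣≡r⇒base : ∀ {B} → Indep B → ∣ B ∣ ≡ r M → IsBase M B
  indep∧∣B∣≡r⇒base {B} iB ∣B∣≡r = iB , λ x x∉B iBx →
    ≤⇒≯ (indep⇒∣I∣≤r iBx) (≤-reflexive (sym (trans (x∉p⇒∣p∪⁅x⁆∣≡1+∣p∣ B x∉B) (cong suc ∣B∣≡r))))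

  base-exists : ∃ (IsBase M)
  base-exists with rank-attained ⊤
  ... | B , _ , iB , ∣B∣≡r = B , indep∧∣B∣≡r⇒base iB ∣B∣≡r

-- The blocks K_M(A)

  Extends : Subset n → Fin n → Set
  Extends A a = a ∉ A × Indep (A ∪ ⁅ a ⁆)

  ∈K⇔rank-step : ∀ {X a} → a ∈ K M X ⇔ rank M (X ∪ ⁅ a ⁆) ≡ rank M X + 1
  ∈K⇔rank-step {X} = ∈-tabulate-⌊⌋ (λ a → rank M (X ∪ ⁅ a ⁆) ≟ rank M X + 1)

  ∈K⇔Extends : ∀ {A a} → Indep A → a ∈ K M A ⇔ Extends A a
  ∈K⇔Extends {A} {a} iA = mk⇔ ∈K⇒Extends Extends⇒∈K
    where
    ∈K⇒Extends : a ∈ K M A → Extends A a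
    ∈K⇒Extends a∈K with rank-attained (A ∪ ⁅ a ⁆)
    ... | I , I⊆A∪a , iI , ∣I∣≡rank with augment iA iI ∣A∣<∣I∣
      where
      ∣A∣<∣I∣ : ∣ A ∣ < ∣ I ∣
      ∣A∣<∣I∣ = ≤-reflexive (begin
        suc ∣ A ∣              ≡⟨ +-comm 1 ∣ A ∣ ⟩
        ∣ A ∣ + 1              ≡⟨ cong (_+ 1) (rank-indep iA) ⟨
        rank M A + 1           ≡⟨ Equivalence.to ∈K⇔rank-step a∈K ⟨
        rank M (A ∪ ⁅ a ⁆)     ≡⟨ ∣I∣≡rank ⟨
        ∣ I ∣                  ∎)
        where open ≡-Reasoning
    ... | x , x∈I , x∉A , iAx =
      subst (Extends A) (∈p∪⁅x⁆∧∉p⇒≡x A (I⊆A∪a x∈I) x∉A) (x∉A , iAx)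

    Extends⇒∈K : Extends A a → a ∈ K M A
    Extends⇒∈K (a∉A , iAa) = Equivalence.from ∈K⇔rank-step (begin
      rank M (A ∪ ⁅ a ⁆)  ≡⟨ rank-indep iAa ⟩
      ∣ A ∪ ⁅ a ⁆ ∣       ≡⟨ x∉p⇒∣p∪⁅x⁆∣≡1+∣p∣ A a∉A ⟩
      suc ∣ A ∣           ≡⟨ +-comm 1 ∣ A ∣ ⟩
      ∣ A ∣ + 1           ≡⟨ cong (_+ 1) (rank-indep iA) ⟨
      rank M A + 1        ∎)
      where open ≡-Reasoning

  base-minus∈s : ∀ {B b} → IsBase M B → b ∈ B → InS M (B - b)
  base-minus∈s {B} {b} (iB , maximal) b∈B =
    indep-⊆ (p─q⊆p B ⁅ b ⁆) iB ,
    cong pred (trans (x∈p⇒1+∣p-x∣≡∣p∣ B b∈B) (base⇒∣B∣≡r (iB , maximal)))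

  b∈K[B-b] : ∀ {B b} → IsBase M B → b ∈ B → b ∈ K M (B - b)
  b∈K[B-b] {B} {b} bB@(iB , _) b∈B =
    Equivalence.from (∈K⇔Extends (proj₁ (base-minus∈s bB b∈B)))
      (x∉p-x B b , indep-⊆ (p⊆q∧x∈q⇒p∪⁅x⁆⊆q (p─q⊆p B ⁅ b ⁆) b∈B) iB)

  ∈K[B-b]∩B⇒≡b : ∀ {B b c} → IsBase M B → b ∈ B → c ∈ B → c ∈ K M (B - b) → c ≡ b
  ∈K[B-b]∩B⇒≡b {B} {b} {c} bB b∈B c∈B c∈K with c Fin.≟ b
  ... | yes c≡b = c≡b
  ... | no  c≢b = contradiction (x∈p∧x≢y⇒x∈p-y c∈B c≢b)
                    (proj₁ (Equivalence.to (∈K⇔Extends (proj₁ (base-minus∈s bB b∈B))) c∈K))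

-- Counting blocks

  F : List (Subset n)
  F = deduplicate (≡-dec Bool._≟_) (map (K M) (sList M))

  F-unique : Unique F
  F-unique = deduplicate-! (≡-dec Bool._≟_) (map (K M) (sList M))

  K∈F : ∀ {A} → InS M A → K M A ∈ˡ F
  K∈F {A} sA = ∈-deduplicate⁺ (≡-dec Bool._≟_)
    (∈-map⁺ (K M) (∈-filter⁺ (inS? M) (∈-allSubsets A) sA))

  ∈F⇒K : ∀ {v} → v ∈ˡ F → ∃ λ A → InS M A × v ≡ K M A
  ∈F⇒K v∈F with ∈-map⁻ (K M) (∈-deduplicate⁻ (≡-dec Bool._≟_) (map (K M) (sList M)) v∈F)
  ... | A , A∈s , v≡KA = A , proj₂ (∈-filter⁻ (inS? M) {xs = allSubsets n} A∈s) , v≡KA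

  baseBlocks : Subset n → List (Subset n)
  baseBlocks B = map (λ b → K M (B - b)) (elements B)

  baseBlocks-unique : ∀ {B} → IsBase M B → Unique (baseBlocks B)
  baseBlocks-unique {B} bB = Unique-map⁺-∈ K[B-b]-injective (elements-unique B)
    where
    K[B-b]-injective : ∀ {b c} → b ∈ˡ elements B → c ∈ˡ elements B →
                       K M (B - b) ≡ K M (B - c) → b ≡ c
    K[B-b]-injective {b} b∈ c∈ K≡K = ∈K[B-b]∩B⇒≡b bB (∈-elements⁻ B c∈) (∈-elements⁻ B b∈)
      (subst (b ∈_) K≡K (b∈K[B-b] bB (∈-elements⁻ B b∈)))

  length-baseBlocks : ∀ {B} → IsBase M B → length (baseBlocks B) ≡ r M
  length-baseBlocks {B} bB =
    trans (length-map _ (elements B)) (trans (length-elements B) (base⇒∣B∣≡r bB))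

  baseBlocks⊆F : ∀ {B} → IsBase M B → baseBlocks B ⊆ˡ F
  baseBlocks⊆F {B} bB v∈ with ∈-map⁻ (λ b → K M (B - b)) v∈
  ... | b , b∈ , refl = K∈F (base-minus∈s bB (∈-elements⁻ B b∈))

  r≤cardF : r M ≤ cardF M
  r≤cardF with base-exists
  ... | B , bB = subst (_≤ cardF M) (length-baseBlocks bB)
                   (Unique⇒length≤ (baseBlocks-unique bB) (baseBlocks⊆F bB))

  distinct-extensions⇒r<cardF : ∀ {A B e₁ e₂} → InS M A → IsBase M B →
    e₁ ∈ B → e₂ ∈ B → e₁ ≢ e₂ → Extends A e₁ → Extends A e₂ → r M < cardF M
  distinct-extensions⇒r<cardF {A} {B} {e₁} {e₂} sA@(iA , _) bB e₁∈B e₂∈B e₁≢e₂ ext₁ ext₂ =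
    subst (_< cardF M) (length-baseBlocks bB)
      (Unique⇒length≤ (All.tabulate KA≢ ∷ baseBlocks-unique bB) KA∷baseBlocks⊆F)
    where
    KA≢ : ∀ {v} → v ∈ˡ baseBlocks B → K M A ≢ v
    KA≢ v∈ KA≡v with ∈-map⁻ (λ b → K M (B - b)) v∈
    ... | b , b∈ , refl = e₁≢e₂ (trans (≡b e₁∈B ext₁) (sym (≡b e₂∈B ext₂)))
      where
      ≡b : ∀ {e} → e ∈ B → Extends A e → e ≡ b
      ≡b e∈B ext = ∈K[B-b]∩B⇒≡b bB (∈-elements⁻ B b∈) e∈B
        (subst (_ ∈_) KA≡v (Equivalence.from (∈K⇔Extends iA) ext))
    KA∷baseBlocks⊆F : K M A ∷ baseBlocks B ⊆ˡ F
    KA∷baseBlocks⊆F (here refl) = K∈F sA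
    KA∷baseBlocks⊆F (there v∈)  = baseBlocks⊆F bB v∈

-- Exchange within s(M)

  module _ (r>0 : 0 < r M) where

    1+∣A∣≡r : ∀ {A} → InS M A → suc ∣ A ∣ ≡ r M
    1+∣A∣≡r (_ , ∣A∣≡r-1) = trans (cong suc ∣A∣≡r-1) (suc-pred (r M) {{>-nonZero r>0}})

    extension-card : ∀ {A a} → InS M A → a ∉ A → ∣ A ∪ ⁅ a ⁆ ∣ ≡ r M
    extension-card {A} sA a∉A = trans (x∉p⇒∣p∪⁅x⁆∣≡1+∣p∣ A a∉A) (1+∣A∣≡r sA)

    extends-into : ∀ {A I} → InS M A → Indep I → ∣ I ∣ ≡ r M → ∃ λ x → x ∈ I × Extends A x
    extends-into sA@(iA , _) iI ∣I∣≡r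
      with augment iA iI (≤-reflexive (trans (1+∣A∣≡r sA) (sym ∣I∣≡r)))
    ... | x , x∈I , x∉A , iAx = x , x∈I , x∉A , iAx

    base-extension⇔Extends : ∀ {A e} → InS M A → IsBase M (A ∪ ⁅ e ⁆) ⇔ Extends A e
    base-extension⇔Extends {A} {e} sA = mk⇔
      (λ bAe → e∉A bAe , proj₁ bAe)
      (λ (e∉A , iAe) → indep∧∣B∣≡r⇒base iAe (extension-card sA e∉A))
      where
      e∉A : IsBase M (A ∪ ⁅ e ⁆) → e ∉ A
      e∉A bAe e∈A = ≤⇒≯ (p⊆q⇒∣p∣≤∣q∣ (p⊆q∧x∈q⇒p∪⁅x⁆⊆q ⊆-refl e∈A))
        (subst (∣ A ∣ <_) (sym (base⇒∣B∣≡r bAe)) (≤-reflexive (1+∣A∣≡r sA)))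

    NoneExtends : Subset n → Subset n → Set
    NoneExtends D A = ∀ {y} → y ∈ D → ¬ Extends A y

    NoneExtends-sym : ∀ {A D} → InS M A → InS M D → NoneExtends D A → NoneExtends A D
    NoneExtends-sym {A} {D} sA sD D↛A {y} y∈A (y∉D , iDy)
      with extends-into sA iDy (extension-card sD y∉D)
    ... | z , z∈D∪y , z∉A , iAz with x∈p∪q⁻ D ⁅ y ⁆ z∈D∪y
    ...   | inj₁ z∈D   = D↛A z∈D (z∉A , iAz)
    ...   | inj₂ z∈⁅y⁆ = z∉A (subst (_∈ A) (sym (x∈⁅y⁆⇒x≡y y z∈⁅y⁆)) y∈A)

    extends-transfer : ∀ {A D a} → InS M A → InS M D → NoneExtends D A →
                       Extends A a → Extends D a
    extends-transfer {A} {D} {a} sA sD D↛A (a∉A , iAa) = a∉D , iDa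
      where
      a∉D : a ∉ D
      a∉D a∈D = D↛A a∈D (a∉A , iAa)
      -- D ∪ {x} is a base for some x ∈ A ∪ {a}; A in turn extends into
      -- D ∪ {x}, necessarily by x, which forces x ∉ A and hence x = a.
      iDa : Indep (D ∪ ⁅ a ⁆)
      iDa with extends-into sD iAa (extension-card sA a∉A)
      ... | x , x∈A∪a , x∉D , iDx with extends-into sA iDx (extension-card sD x∉D)
      ...   | y , y∈D∪x , y∉A , iAy with x∈p∪q⁻ D ⁅ x ⁆ y∈D∪x
      ...     | inj₁ y∈D   = contradiction (y∉A , iAy) (D↛A y∈D)
      ...     | inj₂ y∈⁅x⁆ = subst (λ z → Indep (D ∪ ⁅ z ⁆)) x≡a iDx
        where
        x≡a : x ≡ a
        x≡a = ∈p∪⁅x⁆∧∉p⇒≡x A x∈A∪a (subst (_∉ A) (x∈⁅y⁆⇒x≡y x y∈⁅x⁆) y∉A)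

    K-≡ : ∀ {A D} → InS M A → InS M D → NoneExtends D A → K M A ≡ K M D
    K-≡ sA sD D↛A = ⊆-antisym
      (transfer sA sD D↛A)
      (transfer sD sA (NoneExtends-sym sA sD D↛A))
      where
      transfer : ∀ {A D} → InS M A → InS M D → NoneExtends D A → K M A ⊆ K M D
      transfer sA@(iA , _) sD@(iD , _) D↛A =
        Equivalence.from (∈K⇔Extends iD) ∘ extends-transfer sA sD D↛A ∘ Equivalence.to (∈K⇔Extends iA)

    cardF≡r⇒uniqueExpansion : cardF M ≡ r M → UniqueExpansion M
    cardF≡r⇒uniqueExpansion cardF≡r B bB A sA e₁ e₂ e₁∈B e₂∈B bAe₁ bAe₂ with e₁ Fin.≟ e₂
    ... | yes e₁≡e₂ = e₁≡e₂
    ... | no  e₁≢e₂ = contradiction cardF≡r (>⇒≢ (distinct-extensions⇒r<cardF sA bB e₁∈B e₂∈B e₁≢e₂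
            (Equivalence.to (base-extension⇔Extends sA) bAe₁)
            (Equivalence.to (base-extension⇔Extends sA) bAe₂)))

    uniqueExpansion⇒cardF≤r : UniqueExpansion M → cardF M ≤ r M
    uniqueExpansion⇒cardF≤r ue with base-exists
    ... | B , bB@(iB , _) = subst (cardF M ≤_) (length-baseBlocks bB) (Unique⇒length≤ F-unique F⊆baseBlocks)
      where
      F⊆baseBlocks : F ⊆ˡ baseBlocks B
      F⊆baseBlocks v∈F with ∈F⇒K v∈F
      ... | A , sA , refl with extends-into sA iB (base⇒∣B∣≡r bB)
      ...   | b , b∈B , ext-b =
        subst (_∈ˡ baseBlocks B) (sym (K-≡ sA (base-minus∈s bB b∈B) B-b↛A))
          (∈-map⁺ (λ b → K M (B - b)) (∈-elements⁺ B b∈B))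
        where
        B-b↛A : NoneExtends (B - b) A
        B-b↛A {y} y∈B-b ext-y = x∈p-y⇒x≢y B y∈B-b
          (ue B bB A sA y b (p─q⊆p B ⁅ b ⁆ y∈B-b) b∈B
            (Equivalence.from (base-extension⇔Extends sA) ext-y)
            (Equivalence.from (base-extension⇔Extends sA) ext-b))

theorem5 : ∀ {n : ℕ} (M : Matroid n) → 0 < r M →
           (cardF M ≡ r M) ⇔ UniqueExpansion M
theorem5 M r>0 = mk⇔
  (cardF≡r⇒uniqueExpansion M r>0)
  (λ ue → ≤-antisym (uniqueExpansion⇒cardF≤r M r>0 ue) (r≤cardF M))
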